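{- Let $\Gamma$ be a finite simplicial graph. The geodesic language of $\mathrm{RACG}(\Gamma)$ with respect to the generating set $V\Gamma$ is the language accepted by the finite state automaton over the alphabet $V\Gamma$ whose states are the cliques of $\Gamma$ (all accept states) together with an absorbing reject state $q_{\mathrm{rej}}$, whose start state is the empty clique, and whose transition map on cliques is $\delta(\sigma,v)=(\mathrm{Lk}(v)\cap\sigma)\cup\{v\}$ if $v\notin\sigma$ and $\delta(\sigma,v)=q_{\mathrm{rej}}$ otherwise.
   Context: $\mathrm{RACG}(\Gamma)=\langle v\in V\Gamma\mid v^2=1,\ uv=vu\text{ for }\{u,v\}\in E\Gamma\rangle$. A word over $V\Gamma$ is geodesic if no shorter word represents the same element. A clique is a vertex set spanning a complete subgraph (including the empty set); $\mathrm{Lk}(v)$ is the set of neighbours of $v$. -}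

module Defs where

open import Data.Nat using (ℕ; _≤_)
open import Data.Bool using (Bool; true; false; if_then_else_)
open import Data.Fin using (Fin)
open import Data.Fin.Subset using (Subset; inside; outside; ⊥; ⁅_⁆; _∩_; _∪_)
open import Data.Fin.Subset.Properties using (_∈?_)
open import Data.Vec using (tabulate)
open import Data.List using (List; []; _∷_; _++_; length; foldl)
open import Data.Maybe using (Maybe; just; nothing)
open import Data.Product using (∃)
open import Relation.Nullary using (yes; no)
open import Relation.Binary.PropositionalEquality using (_≡_)
open import Relation.Binary.Construct.Closure.Equivalence using (EqClosure)

record Graph (n : ℕ) : Set where
  field
    adj    : Fin n → Fin n → Bool
    sym    : ∀ u v → adj u v ≡ adj v u
    irrefl : ∀ v → adj v v ≡ false
open Graph public

Word : ℕ → Set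
Word n = List (Fin n)

data Step {n : ℕ} (Γ : Graph n) : Word n → Word n → Set where
  cancel : ∀ xs ys v → Step Γ (xs ++ v ∷ v ∷ ys) (xs ++ ys)
  swap   : ∀ xs ys u v → adj Γ u v ≡ true →
           Step Γ (xs ++ u ∷ v ∷ ys) (xs ++ v ∷ u ∷ ys)

_≈[_]_ : ∀ {n} → Word n → Graph n → Word n → Set
w ≈[ Γ ] w' = EqClosure (Step Γ) w w'

Geodesic : ∀ {n} → Graph n → Word n → Set
Geodesic Γ w = ∀ w' → w' ≈[ Γ ] w → length w ≤ length w'

Lk : ∀ {n} → Graph n → Fin n → Subset n
Lk Γ v = tabulate (λ u → if adj Γ v u then inside else outside)

-- Automaton: states are vertex subsets (reachable ones are cliques), `nothing` = q_rej.
δ : ∀ {n} → Graph n → Maybe (Subset n) → Fin n → Maybe (Subset n)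
δ Γ nothing  v = nothing
δ Γ (just σ) v with v ∈? σ
... | yes _ = nothing
... | no  _ = just ((Lk Γ v ∩ σ) ∪ ⁅ v ⁆)

run : ∀ {n} → Graph n → Word n → Maybe (Subset n)
run Γ w = foldl (δ Γ) (just ⊥) w

Accepts : ∀ {n} → Graph n → Word n → Set
Accepts Γ w = ∃ λ σ → run Γ w ≡ just σ

-- After reading a word, the state of the automaton is the set of its possible last letters:
-- the v that commute to the end of the word.  So a rejected word contains a factor v q v with
-- q commuting with v, and cancelling the two v shortens it.
-- Conversely, record a word by its projections onto the pairs {a, b} of non-adjacent vertices
-- (a = b allowed: these diagonal projections count the letters, hence determine the length).
-- Reading a letter v updates the projections of an accepted word by cancelling v if it is a
-- possible last letter and appending it otherwise; this update respects vv = 1 and uv = vu,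
-- so the projections reached depend only on the group element.  Every word thus has the
-- projections of an accepted word that is no longer than itself, whence accepted words are
-- geodesic.

module Submission where

open import Defs hiding (sym)
open import Data.Nat using (ℕ; suc; _+_; _≤_; z≤n; s≤s)
open import Data.Nat.Properties
  using (+-0-commutativeMonoid; ≤-trans; n≤1+n; m≤n⇒m≤1+n; 1+n≰n; module ≤-Reasoning)
open import Algebra.Properties.CommutativeMonoid.Sum +-0-commutativeMonoid
  using (sum; sum-remove; sum-cong-≗; sum-replicate-zero)
open import Data.Bool using (Bool; true; false; if_then_else_)
import Data.Bool.Properties as Bool
open import Data.Fin using (Fin; punchIn; _≟_)
open import Data.Fin.Properties using (punchInᵢ≢i; all?)
open import Data.Fin.Subset using (Subset; inside; outside; _∈_; _∉_; _∩_; _∪_; ⁅_⁆) renaming (⊥ to ∅)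
open import Data.Fin.Subset.Properties
  using (_∈?_; ∉⊥; x∈⁅x⁆; x∈⁅y⁆⇒x≡y; x∈p∩q⁺; x∈p∩q⁻; x∈p∪q⁺; x∈p∪q⁻)
open import Data.Vec.Properties using ([]=⇒lookup; lookup⇒[]=; lookup∘tabulate)
open import Data.List
  using (List; []; _∷_; _++_; [_]; length; foldl; foldr; filter; head; drop; reverse; _ʳ++_)
open import Data.List.Properties
  using ( filter-++; filter-accept; filter-reject; filter-none; filter-≐; ++-assoc; ++-ʳ++; ʳ++-defn
        ; reverse-involutive; length-reverse; length-++-sucʳ)
open import Data.List.Relation.Unary.All as All using (All; []; _∷_)
import Data.List.Relation.Unary.Any.Properties as Any
open import Data.Maybe using (Maybe; just; nothing)
import Data.Maybe.Properties as Maybe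
open import Data.Product using (∃-syntax; _×_; _,_; map₁)
open import Data.Sum using (_⊎_; inj₁; inj₂; reduce)
open import Function using (_∘_; _⇔_; mk⇔)
open import Relation.Nullary using (Dec; yes; no; ¬_; does; contradiction)
open import Relation.Nullary.Decidable using (_⊎-dec_; _→-dec_; ¬?; dec-true; dec-false; does-⇔)
open import Relation.Unary using (Decidable)
open import Relation.Binary using (Setoid)
open import Relation.Binary.PropositionalEquality hiding ([_])
open import Relation.Binary.Construct.Closure.ReflexiveTransitive using (ε; _◅_; _◅◅_)
open import Relation.Binary.Construct.Closure.Symmetric using (fwd)
import Relation.Binary.Construct.Closure.Equivalence as EqClosure
import Relation.Binary.Reasoning.Setoid as SetoidReasoning

sum-suc-at : ∀ {m} (f g : Fin m → ℕ) (x : Fin m) →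
             g x ≡ suc (f x) → (∀ i → i ≢ x → g i ≡ f i) → sum g ≡ suc (sum f)
sum-suc-at {suc m} f g x gx≡ g≗f = begin
  sum g                           ≡⟨ sum-remove {i = x} g ⟩
  g x + sum (g ∘ punchIn x)       ≡⟨ cong₂ _+_ gx≡ (sum-cong-≗ (λ j → g≗f (punchIn x j) (punchInᵢ≢i x j))) ⟩
  suc (f x + sum (f ∘ punchIn x)) ≡⟨ cong suc (sum-remove {i = x} f) ⟨
  suc (sum f)                     ∎
  where open ≡-Reasoning

length≡∑count : ∀ {m} (xs : List (Fin m)) → length xs ≡ sum (λ v → length (filter (_≟ v) xs))
length≡∑count {m} []   = sym (sum-replicate-zero m)
length≡∑count (x ∷ xs) = begin
  suc (length xs) ≡⟨ cong suc (length≡∑count xs) ⟩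
  suc (sum count) ≡⟨ sum-suc-at count count′ x (cong length (filter-accept (_≟ x) refl))
                       (λ i i≢x → cong length (filter-reject (_≟ i) (i≢x ∘ sym))) ⟨
  sum count′      ∎
  where
  open ≡-Reasoning
  count count′ : Fin _ → ℕ
  count  v = length (filter (_≟ v) xs)
  count′ v = length (filter (_≟ v) (x ∷ xs))

reverse-split : ∀ {A : Set} (p later earlier : List A) v →
                reverse p ≡ later ++ v ∷ earlier → p ≡ reverse earlier ++ v ∷ reverse later
reverse-split p later earlier v split = begin
  p                                ≡⟨ reverse-involutive p ⟨
  reverse (reverse p)              ≡⟨ cong reverse split ⟩
  reverse (later ++ v ∷ earlier)   ≡⟨ ++-ʳ++ later ⟩
  earlier ʳ++ v ∷ reverse later    ≡⟨ ʳ++-defn earlier ⟩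
  reverse earlier ++ v ∷ reverse later ∎
  where open ≡-Reasoning

length-++-∷-++-∷ : ∀ {A : Set} (xs q ys : List A) v →
                   length (xs ++ v ∷ q ++ v ∷ ys) ≡ suc (suc (length (xs ++ q ++ ys)))
length-++-∷-++-∷ []       q ys v = cong suc (length-++-sucʳ q v ys)
length-++-∷-++-∷ (_ ∷ xs) q ys v = cong suc (length-++-∷-++-∷ xs q ys v)

module _ {n : ℕ} (Γ : Graph n) where

  Adjacent : Fin n → Fin n → Set
  Adjacent u v = adj Γ u v ≡ true

  private variable
    a b u v x y : Fin n
    ρ ρ′ q xs ys w w′ : Word n
    σ τ : Subset n
    f g : Word n → Word n
    t : Bool
    k : ℕ

  adjacent? : ∀ u v → Dec (Adjacent u v)
  adjacent? u v = adj Γ u v Bool.≟ true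

  adjacent-sym : Adjacent u v → Adjacent v u
  adjacent-sym {u} {v} = trans (Graph.sym Γ v u)

  adjacent-irrefl : ¬ Adjacent v v
  adjacent-irrefl {v} v~v with () ← trans (sym (irrefl Γ v)) v~v

  ∈-Lk⁻ : v ∈ Lk Γ x → Adjacent x v
  ∈-Lk⁻ {v} {x} v∈ = inside⇒true (adj Γ x v) (trans (sym (lookup∘tabulate _ v)) ([]=⇒lookup v∈))
    where
    inside⇒true : ∀ t → (if t then inside else outside) ≡ inside → t ≡ true
    inside⇒true true  _ = refl
    inside⇒true false ()

  ∈-Lk⁺ : Adjacent x v → v ∈ Lk Γ x
  ∈-Lk⁺ {x} {v} x~v =
    lookup⇒[]= v (Lk Γ x) (trans (lookup∘tabulate _ v) (cong (λ t → if t then inside else outside) x~v))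

  next : Fin n → Subset n → Subset n
  next x σ = (Lk Γ x ∩ σ) ∪ ⁅ x ⁆

  ∈-next-self : x ∈ next x σ
  ∈-next-self {x} = x∈p∪q⁺ (inj₂ (x∈⁅x⁆ x))

  ∈-next⁺ : Adjacent x v → v ∈ σ → v ∈ next x σ
  ∈-next⁺ x~v v∈σ = x∈p∪q⁺ (inj₁ (x∈p∩q⁺ (∈-Lk⁺ x~v , v∈σ)))

  ∈-next⁻ : v ∈ next x σ → v ≡ x ⊎ (Adjacent x v × v ∈ σ)
  ∈-next⁻ {v} {x} {σ} v∈ with x∈p∪q⁻ (Lk Γ x ∩ σ) ⁅ x ⁆ v∈
  ... | inj₁ v∈Lk∩σ = inj₂ (map₁ ∈-Lk⁻ (x∈p∩q⁻ (Lk Γ x) σ v∈Lk∩σ))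
  ... | inj₂ v∈⁅x⁆  = inj₁ (x∈⁅y⁆⇒x≡y x v∈⁅x⁆)

  -- An accepting run on a word written backwards (head = letter read last), ending in state σ.
  data Run : Word n → Subset n → Set where
    []  : Run [] ∅
    _∷_ : x ∉ σ → Run ρ σ → Run (x ∷ ρ) (next x σ)

  foldl-δ-nothing : ∀ ys → foldl (δ Γ) nothing ys ≡ nothing
  foldl-δ-nothing []       = refl
  foldl-δ-nothing (_ ∷ ys) = foldl-δ-nothing ys

  foldl-δ⇒Run : ∀ ys → Run ρ τ → foldl (δ Γ) (just τ) ys ≡ just σ → Run (ys ʳ++ ρ) σ
  foldl-δ⇒Run []       r refl = r
  foldl-δ⇒Run {τ = τ} (y ∷ ys) r e with y ∈? τ
  ... | yes _  = contradiction (trans (sym (foldl-δ-nothing ys)) e) λ ()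
  ... | no y∉τ = foldl-δ⇒Run ys (y∉τ ∷ r) e

  first-rejection : ∀ w → Run ρ σ → foldl (δ Γ) (just σ) w ≡ nothing →
    ∃[ p ] ∃[ v ] ∃[ rest ] ∃[ τ ] w ≡ p ++ v ∷ rest × Run (p ʳ++ ρ) τ × v ∈ τ
  first-rejection []                 r ()
  first-rejection {σ = σ} (y ∷ ys) r rejected with y ∈? σ
  ... | yes y∈σ = [] , y , ys , σ , refl , r , y∈σ
  ... | no y∉σ with first-rejection ys (y∉σ ∷ r) rejected
  ...   | p , v , rest , τ , refl , p-run , v∈τ = y ∷ p , v , rest , τ , refl , p-run , v∈τ

  -- Each letter of the final state is a last letter of ρ; the field adjacent-retained only serves
  -- the induction in ∈final⇒Deletion.
  record Deletion (v : Fin n) (σ : Subset n) (ρ : Word n) : Set where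
    field
      later earlier     : Word n
      split             : ρ ≡ later ++ v ∷ earlier
      later-adjacent    : All (Adjacent v) later
      remaining         : Subset n
      remaining-run     : Run (later ++ earlier) remaining
      v∉remaining       : v ∉ remaining
      adjacent-retained : Adjacent v u → u ∈ remaining → u ∈ σ

  ∈final⇒Deletion : Run ρ σ → v ∈ σ → Deletion v σ ρ
  ∈final⇒Deletion [] v∈∅ = contradiction v∈∅ ∉⊥
  ∈final⇒Deletion {x ∷ ρ} {v = v} (_∷_ {σ = σ} x∉σ r) v∈ with ∈-next⁻ v∈
  ... | inj₁ refl = record
    { later = [] ; earlier = ρ ; split = refl ; later-adjacent = []
    ; remaining = σ ; remaining-run = r ; v∉remaining = x∉σ ; adjacent-retained = ∈-next⁺ }
  ... | inj₂ (x~v , v∈σ) = prepend (∈final⇒Deletion r v∈σ)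
    where
    prepend : Deletion v σ ρ → Deletion v (next x σ) (x ∷ ρ)
    prepend d = record
      { later = x ∷ later ; earlier = earlier ; split = cong (x ∷_) split
      ; later-adjacent = adjacent-sym x~v ∷ later-adjacent
      ; remaining = next x remaining ; remaining-run = x∉remaining ∷ remaining-run
      ; v∉remaining = v∉next ; adjacent-retained = retained }
      where
      open Deletion d
      x∉remaining : x ∉ remaining
      x∉remaining = x∉σ ∘ adjacent-retained (adjacent-sym x~v)
      v∉next : v ∉ next x remaining
      v∉next v∈next with ∈-next⁻ v∈next
      ... | inj₁ refl              = adjacent-irrefl x~v
      ... | inj₂ (_ , v∈remaining) = v∉remaining v∈remaining
      retained : Adjacent v u → u ∈ next x remaining → u ∈ next x σ
      retained v~u u∈next with ∈-next⁻ u∈next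
      ... | inj₁ refl                = ∈-next-self
      ... | inj₂ (x~u , u∈remaining) = ∈-next⁺ x~u (adjacent-retained v~u u∈remaining)

  OneOf : Fin n → Fin n → Fin n → Set
  OneOf a b x = x ≡ a ⊎ x ≡ b

  oneOf? : ∀ a b → Decidable (OneOf a b)
  oneOf? a b x = (x ≟ a) ⊎-dec (x ≟ b)

  adjacent-∉-pair : OneOf a b v → ¬ Adjacent a b → Adjacent v y → ¬ OneOf a b y
  adjacent-∉-pair (inj₁ refl) a≁b v~y (inj₁ refl) = adjacent-irrefl v~y
  adjacent-∉-pair (inj₁ refl) a≁b v~y (inj₂ refl) = a≁b v~y
  adjacent-∉-pair (inj₂ refl) a≁b v~y (inj₁ refl) = a≁b (adjacent-sym v~y)
  adjacent-∉-pair (inj₂ refl) a≁b v~y (inj₂ refl) = adjacent-irrefl v~y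

  Projection : Set
  Projection = Fin n → Fin n → Word n

  proj : Word n → Projection
  proj ρ a b = filter (oneOf? a b) ρ

  _≐_ : Projection → Projection → Set
  P ≐ Q = ∀ a b → ¬ Adjacent a b → P a b ≡ Q a b

  ≐-setoid : Setoid _ _
  ≐-setoid = record
    { Carrier       = Projection
    ; _≈_           = _≐_
    ; isEquivalence = record
      { refl  = λ _ _ _ → refl
      ; sym   = λ P≐Q a b a≁b → sym (P≐Q a b a≁b)
      ; trans = λ P≐Q Q≐R a b a≁b → trans (P≐Q a b a≁b) (Q≐R a b a≁b)
      }
    }

  open Setoid ≐-setoid using ()
    renaming (refl to ≐-refl; sym to ≐-sym; trans to ≐-trans; isEquivalence to ≐-isEquivalence)
  module ≐-Reasoning = SetoidReasoning ≐-setoid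

  private variable
    P Q : Projection

  proj-skip : All (Adjacent v) ys → OneOf a b v → ¬ Adjacent a b →
              ∀ zs → proj (ys ++ zs) a b ≡ proj zs a b
  proj-skip {ys = ys} {a} {b} v~ys v∈ab a≁b zs = begin
    filter (oneOf? a b) (ys ++ zs)                   ≡⟨ filter-++ (oneOf? a b) ys zs ⟩
    filter (oneOf? a b) ys ++ filter (oneOf? a b) zs ≡⟨ cong (_++ _) (filter-none (oneOf? a b) ys∌ab) ⟩
    filter (oneOf? a b) zs                           ∎
    where
    open ≡-Reasoning
    ys∌ab : All (¬_ ∘ OneOf a b) ys
    ys∌ab = All.map (adjacent-∉-pair v∈ab a≁b) v~ys

  proj-remove : ¬ OneOf a b v → ∀ ys zs → proj (ys ++ v ∷ zs) a b ≡ proj (ys ++ zs) a b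
  proj-remove {a} {b} {v} v∉ab ys zs = begin
    filter (oneOf? a b) (ys ++ v ∷ zs)                     ≡⟨ filter-++ (oneOf? a b) ys (v ∷ zs) ⟩
    filter (oneOf? a b) ys ++ filter (oneOf? a b) (v ∷ zs) ≡⟨ cong (_ ++_) (filter-reject (oneOf? a b) v∉ab) ⟩
    filter (oneOf? a b) ys ++ filter (oneOf? a b) zs       ≡⟨ filter-++ (oneOf? a b) ys zs ⟨
    filter (oneOf? a b) (ys ++ zs)                         ∎
    where open ≡-Reasoning

  proj-move : All (Adjacent v) ys → ∀ zs → proj (v ∷ ys ++ zs) ≐ proj (ys ++ v ∷ zs)
  proj-move {v} {ys} v~ys zs a b a≁b with oneOf? a b v
  ... | yes v∈ab = begin
    proj (v ∷ ys ++ zs) a b ≡⟨ filter-accept (oneOf? a b) v∈ab ⟩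
    v ∷ proj (ys ++ zs) a b ≡⟨ cong (v ∷_) (proj-skip v~ys v∈ab a≁b zs) ⟩
    v ∷ proj zs a b         ≡⟨ filter-accept (oneOf? a b) v∈ab ⟨
    proj (v ∷ zs) a b       ≡⟨ proj-skip v~ys v∈ab a≁b (v ∷ zs) ⟨
    proj (ys ++ v ∷ zs) a b ∎
    where open ≡-Reasoning
  ... | no v∉ab = trans (filter-reject (oneOf? a b) v∉ab) (sym (proj-remove v∉ab ys zs))

  -- Opaque so that f and P can be inferred from modifyPairs v f P a b; likewise for EndsWith below.
  opaque
    modifyPairs : Fin n → (Word n → Word n) → Projection → Projection
    modifyPairs v f P a b = if does (oneOf? a b v) then f (P a b) else P a b

    modifyPairs-∈ : OneOf a b v → modifyPairs v f P a b ≡ f (P a b)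
    modifyPairs-∈ {a} {b} {v} v∈ab rewrite dec-true (oneOf? a b v) v∈ab = refl

    modifyPairs-∉ : ¬ OneOf a b v → modifyPairs v f P a b ≡ P a b
    modifyPairs-∉ {a} {b} {v} v∉ab rewrite dec-false (oneOf? a b v) v∉ab = refl

    modifyPairs-cong : P a b ≡ Q a b → modifyPairs v f P a b ≡ modifyPairs v f Q a b
    modifyPairs-cong {a = a} {b} {v = v} {f} = cong (λ l → if does (oneOf? a b v) then f l else l)

  modifyPairs-comm : Adjacent u v →
                     modifyPairs u f (modifyPairs v g P) ≐ modifyPairs v g (modifyPairs u f P)
  modifyPairs-comm u~v a b a≁b with oneOf? a b _ | oneOf? a b _
  ... | yes u∈ab | yes v∈ab = contradiction v∈ab (adjacent-∉-pair u∈ab a≁b u~v)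
  ... | _        | no v∉ab  = trans (modifyPairs-cong (modifyPairs-∉ v∉ab)) (sym (modifyPairs-∉ v∉ab))
  ... | no u∉ab  | yes _    = trans (modifyPairs-∉ u∉ab) (modifyPairs-cong (sym (modifyPairs-∉ u∉ab)))

  modifyPairs-append-proj : ∀ a b → modifyPairs v (v ∷_) (proj ρ) a b ≡ proj (v ∷ ρ) a b
  modifyPairs-append-proj {v} a b with oneOf? a b v
  ... | yes v∈ab = trans (modifyPairs-∈ v∈ab) (sym (filter-accept (oneOf? a b) v∈ab))
  ... | no  v∉ab = trans (modifyPairs-∉ v∉ab) (sym (filter-reject (oneOf? a b) v∉ab))

  modifyPairs-drop-proj : ∀ a b → modifyPairs v (drop 1) (proj (v ∷ ρ)) a b ≡ proj ρ a b
  modifyPairs-drop-proj {v} a b with oneOf? a b v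
  ... | yes v∈ab = trans (modifyPairs-∈ v∈ab) (cong (drop 1) (filter-accept (oneOf? a b) v∈ab))
  ... | no  v∉ab = trans (modifyPairs-∉ v∉ab) (filter-reject (oneOf? a b) v∉ab)

  opaque
    -- On the projections of a word: v is a last letter, i.e. it commutes to the end of the word.
    EndsWith : Projection → Fin n → Set
    EndsWith P v = ∀ b → ¬ Adjacent v b → head (P v b) ≡ just v

    endsWith? : ∀ P v → Dec (EndsWith P v)
    endsWith? P v = all? λ b → ¬? (adjacent? v b) →-dec Maybe.≡-dec _≟_ (head (P v b)) (just v)

    endsWith-head : EndsWith P v → ¬ Adjacent v b → head (P v b) ≡ just v
    endsWith-head P-ends = P-ends _

    endsWith-resp : (∀ b → ¬ Adjacent v b → P v b ≡ Q v b) → EndsWith P v → EndsWith Q v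
    endsWith-resp P≡Q P-ends b v≁b = trans (cong head (sym (P≡Q b v≁b))) (P-ends b v≁b)

    endsWith-proj-∷ : EndsWith (proj (v ∷ ρ)) v
    endsWith-proj-∷ {v} b _ = cong head (filter-accept (oneOf? v b) (inj₁ refl))

  endsWith⇒∈final : Run ρ σ → EndsWith (proj ρ) v → v ∈ σ
  endsWith⇒∈final {v = v} [] ends with () ← endsWith-head {b = v} ends adjacent-irrefl
  endsWith⇒∈final {x ∷ ρ} {v = v} (_ ∷ r) ends with v ≟ x | adjacent? x v
  ... | yes refl | _       = ∈-next-self
  ... | no v≢x   | yes x~v = ∈-next⁺ x~v (endsWith⇒∈final r (endsWith-resp skip-x ends))
    where
    skip-x : ∀ b → ¬ Adjacent v b → proj (x ∷ ρ) v b ≡ proj ρ v b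
    skip-x b v≁b = filter-reject (oneOf? v b) (adjacent-∉-pair (inj₁ refl) v≁b (adjacent-sym x~v))
  ... | no v≢x   | no x≁v  =
    contradiction (Maybe.just-injective (trans (cong head (sym (filter-accept (oneOf? v x) (inj₂ refl))))
                                               (endsWith-head ends (x≁v ∘ adjacent-sym))))
                  (v≢x ∘ sym)

  cancelOrAppend : Bool → Fin n → Word n → Word n
  cancelOrAppend true  _ = drop 1
  cancelOrAppend false v = v ∷_

  act : Fin n → Projection → Projection
  act v P = modifyPairs v (cancelOrAppend (does (endsWith? P v)) v) P

  act-decided : does (endsWith? P v) ≡ t →
                ∀ a b → act v P a b ≡ modifyPairs v (cancelOrAppend t v) P a b
  act-decided {P} {v} P-ends≡t a b = cong (λ t → modifyPairs v (cancelOrAppend t v) P a b) P-ends≡t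

  act-resp : P ≐ Q → act v P ≐ act v Q
  act-resp {P} {Q} {v} P≐Q a b a≁b = trans (act-decided same-decision a b) (modifyPairs-cong (P≐Q a b a≁b))
    where
    same-decision : does (endsWith? P v) ≡ does (endsWith? Q v)
    same-decision = does-⇔ (mk⇔ (endsWith-resp (P≐Q v)) (endsWith-resp (≐-sym P≐Q v)))
                           (endsWith? P v) (endsWith? Q v)

  endsWith-act : Adjacent u v → EndsWith (act v P) u ⇔ EndsWith P u
  endsWith-act {u} {v} {P} u~v = mk⇔ (endsWith-resp row) (endsWith-resp (λ b → sym ∘ row b))
    where
    row : ∀ b → ¬ Adjacent u b → act v P u b ≡ P u b
    row b u≁b = modifyPairs-∉ (adjacent-∉-pair (inj₁ refl) u≁b u~v)

  act-swap : Adjacent u v → act u (act v P) ≐ act v (act u P)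
  act-swap {u} {v} {P} u~v a b a≁b = begin
    act u (act v P) a b                                                   ≡⟨ act-decided u-decision a b ⟩
    modifyPairs u (cancelOrAppend (does (endsWith? P u)) u) (act v P) a b ≡⟨ modifyPairs-comm u~v a b a≁b ⟩
    modifyPairs v (cancelOrAppend (does (endsWith? P v)) v) (act u P) a b ≡⟨ act-decided v-decision a b ⟨
    act v (act u P) a b                                                   ∎
    where
    open ≡-Reasoning
    u-decision : does (endsWith? (act v P) u) ≡ does (endsWith? P u)
    u-decision = does-⇔ (endsWith-act u~v) (endsWith? (act v P) u) (endsWith? P u)
    v-decision : does (endsWith? (act u P) v) ≡ does (endsWith? P v)
    v-decision = does-⇔ (endsWith-act (adjacent-sym u~v)) (endsWith? (act u P) v) (endsWith? P v)

  act-append : Run ρ σ → v ∉ σ → act v (proj ρ) ≐ proj (v ∷ ρ)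
  act-append {v = v} r v∉σ a b _ =
    trans (act-decided (dec-false (endsWith? _ v) (v∉σ ∘ endsWith⇒∈final r)) a b) (modifyPairs-append-proj a b)

  act-cancel-last : ∀ ρ → act v (proj (v ∷ ρ)) ≐ proj ρ
  act-cancel-last {v} ρ a b _ =
    trans (act-decided (dec-true (endsWith? _ v) endsWith-proj-∷) a b) (modifyPairs-drop-proj a b)

  act-cancel : ∀ {later} earlier → All (Adjacent v) later →
               act v (proj (later ++ v ∷ earlier)) ≐ proj (later ++ earlier)
  act-cancel {later = later} earlier v~later =
    ≐-trans (act-resp (≐-sym (proj-move v~later earlier))) (act-cancel-last (later ++ earlier))

  act-involutive-proj : Run ρ σ → act v (act v (proj ρ)) ≐ proj ρ
  act-involutive-proj {ρ} {σ} {v} r with v ∈? σ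
  ... | no v∉σ = ≐-trans (act-resp (act-append r v∉σ)) (act-cancel-last ρ)
  ... | yes v∈σ with ∈final⇒Deletion r v∈σ
  ... | record { later = later ; earlier = earlier ; split = refl ; later-adjacent = v~later
               ; remaining-run = r′ ; v∉remaining = v∉σ′ } = begin
    act v (act v (proj (later ++ v ∷ earlier))) ≈⟨ act-resp (act-cancel earlier v~later) ⟩
    act v (proj (later ++ earlier))             ≈⟨ act-append r′ v∉σ′ ⟩
    proj (v ∷ later ++ earlier)                 ≈⟨ proj-move v~later earlier ⟩
    proj (later ++ v ∷ earlier)                 ∎
    where open ≐-Reasoning

  record Realised (P : Projection) (k : ℕ) : Set where
    constructor realised
    field
      word     : Word n
      final    : Subset n
      word-run : Run word final
      projects : P ≐ proj word
      short    : length word ≤ k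

  act-realised : Realised P k → Realised (act v P) (suc k)
  act-realised {v = v} (realised ρ σ r P≐ρ ρ≤k) with v ∈? σ
  ... | no v∉σ =
    realised (v ∷ ρ) (next v σ) (v∉σ ∷ r) (≐-trans (act-resp P≐ρ) (act-append r v∉σ)) (s≤s ρ≤k)
  ... | yes v∈σ with ∈final⇒Deletion r v∈σ
  ... | record { later = later ; earlier = earlier ; split = refl ; later-adjacent = v~later
               ; remaining = σ′ ; remaining-run = r′ } =
    realised (later ++ earlier) σ′ r′ (≐-trans (act-resp P≐ρ) (act-cancel earlier v~later))
      (m≤n⇒m≤1+n (≤-trans (n≤1+n _) (subst (_≤ _) (length-++-sucʳ later v earlier) ρ≤k)))

  act-involutive : Realised P k → act v (act v P) ≐ P
  act-involutive {P} {v = v} (realised ρ _ r P≐ρ _) = begin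
    act v (act v P)        ≈⟨ act-resp (act-resp P≐ρ) ⟩
    act v (act v (proj ρ)) ≈⟨ act-involutive-proj r ⟩
    proj ρ                 ≈⟨ P≐ρ ⟨
    P                      ∎
    where open ≐-Reasoning

  image : Word n → Projection
  image = foldr act (proj [])

  image-realised : ∀ ρ → Realised (image ρ) (length ρ)
  image-realised []      = realised [] ∅ [] ≐-refl z≤n
  image-realised (x ∷ ρ) = act-realised (image-realised ρ)

  image-run : Run ρ σ → image ρ ≐ proj ρ
  image-run []          = ≐-refl
  image-run (x∉σ ∷ r) = ≐-trans (act-resp (image-run r)) (act-append r x∉σ)

  image-resp-ʳ++ : ∀ ys → image ρ ≐ image ρ′ → image (ys ʳ++ ρ) ≐ image (ys ʳ++ ρ′)
  image-resp-ʳ++ []       ρ≐ρ′ = ρ≐ρ′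
  image-resp-ʳ++ (y ∷ ys) ρ≐ρ′ = image-resp-ʳ++ ys (act-resp ρ≐ρ′)

  image-step : Step Γ w w′ → image (reverse w) ≐ image (reverse w′)
  image-step (cancel xs ys v) = begin
    image (reverse (xs ++ v ∷ v ∷ ys)) ≡⟨ cong image (++-ʳ++ xs) ⟩
    image (ys ʳ++ v ∷ v ∷ reverse xs)  ≈⟨ image-resp-ʳ++ ys (act-involutive (image-realised (reverse xs))) ⟩
    image (ys ʳ++ reverse xs)          ≡⟨ cong image (++-ʳ++ xs) ⟨
    image (reverse (xs ++ ys))         ∎
    where open ≐-Reasoning
  image-step (swap xs ys u v u~v) = begin
    image (reverse (xs ++ u ∷ v ∷ ys)) ≡⟨ cong image (++-ʳ++ xs) ⟩
    image (ys ʳ++ v ∷ u ∷ reverse xs)  ≈⟨ image-resp-ʳ++ ys (act-swap (adjacent-sym u~v)) ⟩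
    image (ys ʳ++ u ∷ v ∷ reverse xs)  ≡⟨ cong image (++-ʳ++ xs) ⟨
    image (reverse (xs ++ v ∷ u ∷ ys)) ∎
    where open ≐-Reasoning

  image-resp-≈ : w ≈[ Γ ] w′ → image (reverse w) ≐ image (reverse w′)
  image-resp-≈ = EqClosure.gfold ≐-isEquivalence (image ∘ reverse) image-step

  length-resp-proj : ∀ ρ ρ′ → proj ρ ≐ proj ρ′ → length ρ ≡ length ρ′
  length-resp-proj ρ ρ′ ρ≐ρ′ = begin
    length ρ                              ≡⟨ length≡∑count ρ ⟩
    sum (λ v → length (filter (_≟ v) ρ))  ≡⟨ sum-cong-≗ (λ v → cong length (diagonal v)) ⟩
    sum (λ v → length (filter (_≟ v) ρ′)) ≡⟨ length≡∑count ρ′ ⟨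
    length ρ′                             ∎
    where
    open ≡-Reasoning
    proj-diagonal : ∀ ρ v → proj ρ v v ≡ filter (_≟ v) ρ
    proj-diagonal ρ v = filter-≐ (oneOf? v v) (_≟ v) (reduce , inj₁) ρ
    diagonal : ∀ v → filter (_≟ v) ρ ≡ filter (_≟ v) ρ′
    diagonal v = trans (sym (proj-diagonal ρ v)) (trans (ρ≐ρ′ v v adjacent-irrefl) (proj-diagonal ρ′ v))

  accepted⇒geodesic : Accepts Γ w → Geodesic Γ w
  accepted⇒geodesic {w} (_ , w-accepted) w′ w′≈w with image-realised (reverse w′)
  ... | realised ρ _ _ w′≐ρ ρ≤w′ = begin
    length w            ≡⟨ length-reverse w ⟨
    length (reverse w)  ≡⟨ length-resp-proj (reverse w) ρ w≐ρ ⟩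
    length ρ            ≤⟨ ρ≤w′ ⟩
    length (reverse w′) ≡⟨ length-reverse w′ ⟩
    length w′           ∎
    where
    open ≤-Reasoning
    w≐ρ : proj (reverse w) ≐ proj ρ
    w≐ρ = ≐-trans (≐-sym (image-run (foldl-δ⇒Run w [] w-accepted)))
                  (≐-trans (≐-sym (image-resp-≈ w′≈w)) w′≐ρ)

  commute-past : All (Adjacent v) q → (xs ++ v ∷ q ++ ys) ≈[ Γ ] (xs ++ q ++ v ∷ ys)
  commute-past [] = ε
  commute-past {v} {y ∷ q} {xs} {ys} (v~y ∷ v~q) =
    fwd (swap xs (q ++ ys) v y v~y) ◅
    subst₂ (λ s t → s ≈[ Γ ] t) (++-assoc xs [ y ] (v ∷ q ++ ys)) (++-assoc xs [ y ] (q ++ v ∷ ys))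
      (commute-past {xs = xs ++ [ y ]} v~q)

  cancel-repeated : All (Adjacent v) q → (xs ++ v ∷ q ++ v ∷ ys) ≈[ Γ ] (xs ++ q ++ ys)
  cancel-repeated {v} {q} {xs} {ys} v~q =
    commute-past v~q ◅◅
    subst₂ (λ s t → s ≈[ Γ ] t) (++-assoc xs q (v ∷ v ∷ ys)) (++-assoc xs q ys)
      (EqClosure.return (cancel (xs ++ q) ys v))

  repeated-¬geodesic : All (Adjacent v) q → ¬ Geodesic Γ (xs ++ v ∷ q ++ v ∷ ys)
  repeated-¬geodesic {v} {q} {xs} {ys} v~q geodesic =
    1+n≰n (≤-trans (n≤1+n _) (subst (_≤ _) (length-++-∷-++-∷ xs q ys v)
                                         (geodesic _ (EqClosure.symmetric _ (cancel-repeated v~q)))))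

  rejected⇒¬geodesic : run Γ w ≡ nothing → ¬ Geodesic Γ w
  rejected⇒¬geodesic {w} rejected with first-rejection w [] rejected
  ... | p , v , rest , τ , refl , p-run , v∈τ with ∈final⇒Deletion p-run v∈τ
  ... | record { later = later ; earlier = earlier ; split = split ; later-adjacent = v~later } =
    subst (¬_ ∘ Geodesic Γ) (sym w≡) (repeated-¬geodesic (All.tabulate (All.lookup v~later ∘ Any.reverse⁻)))
    where
    w≡ : p ++ v ∷ rest ≡ reverse earlier ++ v ∷ reverse later ++ v ∷ rest
    w≡ = trans (cong (_++ v ∷ rest) (reverse-split p later earlier v split))
               (++-assoc (reverse earlier) (v ∷ reverse later) (v ∷ rest))

  geodesic⇒accepted : Geodesic Γ w → Accepts Γ w
  geodesic⇒accepted {w} geodesic with run Γ w in e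
  ... | just σ  = σ , refl
  ... | nothing = contradiction geodesic (rejected⇒¬geodesic e)

proposition6p2 : (n : ℕ) (Γ : Graph n) (w : Word n) → Geodesic Γ w ⇔ Accepts Γ w
proposition6p2 n Γ w = mk⇔ (geodesic⇒accepted Γ) (accepted⇒geodesic Γ)
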